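{- Fix integers $d\ge 3$ and $n \ge 2$. Let $\bar T_n$ be the wired $d$-regular tree of height $n$ (defined in the context), with root $r$. A chip configuration constant on levels is represented by a vector $(a_1,\dots,a_{n-1})$, where $a_k$ is the number of chips at each vertex at distance $k-1$ from the root. Order such vectors lexicographically from the last coordinate: $\mathbf a<\mathbf b$ if for some $k$, $a_{n-1}=b_{n-1},\dots,a_{k+1}=b_{k+1}$ and $a_k<b_k$. For recurrent configurations $u,v$ on $\bar T_n$ that are constant on levels, write $u \leadsto v$ if either $v$ immediately follows $u$ in this lexicographic order on the set of recurrent configurations constant on levels, or $u=(d-1,\dots,d-1)$ and $v=(d-1,\dots,d-1,0)$. Then for every integer $k\ge 0$, \[ (k\hat r)^\circ \leadsto ((k+1)\hat r)^\circ, \] where $(k\hat r)^\circ = (e+k\delta_r)^\circ$ denotes the $k$-th multiple of $\hat r$ in the sandpile group ($e$ for $k=0$).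
   Context: $T_n$ is the finite rooted tree in which every non-leaf vertex has $d-1$ children and every leaf is at distance $n-1$ from the root; $\bar T_n$ is obtained by identifying all leaves to one sink $s$ (keeping parallel edges) and adding one edge from the root $r$ to $s$; thus every non-sink vertex has degree $d$. Chip configurations are functions from non-sink vertices to $\mathbb{Z}_{\ge0}$; a vertex with at least $d$ chips may topple, sending one chip along each incident edge (chips to $s$ vanish); $u^\circ$ is the unique stable configuration obtained by toppling until stable. A stable $u$ is recurrent if $(u+v)^\circ=u$ for some nonzero $v$. The sandpile group $SP(\bar T_n)$ is the set of recurrent configurations under $(u,v)\mapsto(u+v)^\circ$, with identity $e$; $\delta_r$ is one chip at $r$ and $\hat r=(e+\delta_r)^\circ$. -}

module Defs where

open import Data.Nat using (ℕ; zero; suc; _+_; _*_; _∸_; _≤_; _<_; _≡ᵇ_)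
open import Data.Fin using (Fin; toℕ; fromℕ<)
import Data.Fin as Fin
open import Data.List using (List; []; _∷_; length)
open import Data.List.Properties using (≡-dec)
open import Data.Product using (Σ; ∃; _×_; _,_; proj₁; proj₂)
open import Data.Sum using (_⊎_)
open import Data.Bool using (Bool; true; false; if_then_else_)
open import Relation.Nullary using (¬_)
open import Relation.Nullary.Decidable using (⌊_⌋)
open import Relation.Binary.PropositionalEquality using (_≡_)

module Sandpile (d n : ℕ) where

  -- A non-sink vertex is a vertex of T_n at distance ≤ n-2 from the root,
  -- encoded by its path from the root, written in REVERSE order
  -- (the most recent child index is at the head): the children of p are
  -- i ∷ p for i : Fin (d-1).
  Vertex : Set
  Vertex = Σ (List (Fin (d ∸ 1))) (λ p → length p < n ∸ 1)

  -- distance from the root, as an index into level vectors (a_1,…,a_{n-1}):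
  -- index j : Fin (n-1) stands for a_{j+1}
  depth : Vertex → Fin (n ∸ 1)
  depth (p , lt) = fromℕ< lt

  _≟L_ : (p q : List (Fin (d ∸ 1))) → Relation.Nullary.Dec (p ≡ q)
  _≟L_ = ≡-dec Fin._≟_

  sameV : Vertex → Vertex → Bool
  sameV v w = ⌊ proj₁ v ≟L proj₁ w ⌋

  isChildOf : List (Fin (d ∸ 1)) → List (Fin (d ∸ 1)) → Bool
  isChildOf [] q = false
  isChildOf (i ∷ p) q = ⌊ p ≟L q ⌋

  b2n : Bool → ℕ
  b2n true = 1
  b2n false = 0

  -- number of edges between non-sink vertices v and w
  -- (the tree has no multiple edges among non-sink vertices; all edges
  --  from level n-2 to the leaves and the root edge go to the sink)
  adj : Vertex → Vertex → ℕ
  adj v w = b2n (isChildOf (proj₁ w) (proj₁ v)) + b2n (isChildOf (proj₁ v) (proj₁ w))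

  Config : Set
  Config = Vertex → ℕ

  _⊕_ : Config → Config → Config
  (u ⊕ v) w = u w + v w

  kδr : ℕ → Config
  kδr k w = if length (proj₁ w) ≡ᵇ 0 then k else 0

  topple : Config → Vertex → Config
  topple c v w = (if sameV w v then c w ∸ d else c w) + adj v w

  Stable : Config → Set
  Stable c = ∀ v → c v < d

  data Reach : Config → Config → Set where
    done : ∀ {c s} → (∀ w → c w ≡ s w) → Reach c s
    step : ∀ {c s} v → d ≤ c v → Reach (topple c v) s → Reach c s

  Stab : Config → Config → Set
  Stab c s = Reach c s × Stable s

  Recurrent : Config → Set
  Recurrent u = Stable u × ∃ λ (v : Config) → ¬ (∀ w → v w ≡ 0) × Stab (u ⊕ v) u

  IsIdentity : Config → Set
  IsIdentity e = Recurrent e × (∀ u → Recurrent u → Stab (e ⊕ u) u)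

  LevelVec : Set
  LevelVec = Fin (n ∸ 1) → ℕ

  levelConfig : LevelVec → Config
  levelConfig a w = a (depth w)

  HasLevels : Config → LevelVec → Set
  HasLevels u a = ∀ w → u w ≡ a (depth w)

  _<lex_ : LevelVec → LevelVec → Set
  a <lex b = ∃ λ (k : Fin (n ∸ 1)) →
    (∀ (j : Fin (n ∸ 1)) → toℕ k < toℕ j → a j ≡ b j) × a k < b k

  ImmediateSucc : LevelVec → LevelVec → Set
  ImmediateSucc a b = a <lex b ×
    (∀ c → Recurrent (levelConfig c) → ¬ (a <lex c × c <lex b))

  allMax : LevelVec
  allMax j = d ∸ 1

  wrapVec : LevelVec
  wrapVec j = if toℕ j ≡ᵇ (n ∸ 2) then 0 else d ∸ 1

  _⇝_ : Config → Config → Set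
  u ⇝ v = Recurrent u × Recurrent v × ∃ λ a → ∃ λ b →
    HasLevels u a × HasLevels v b ×
    (ImmediateSucc a b ⊎ ((∀ j → a j ≡ allMax j) × (∀ j → b j ≡ wrapVec j)))

module Submission where

-- The identity e absorbs its image under every automorphism of the tree, so by confluence it equals
-- that image and is constant on levels; hence so is every (e + kδ_r)°, which can be followed on level
-- vectors.  Adding a chip at the root of a stable level vector triggers a cascade: if K is the least
-- depth holding fewer than d - 1 chips, depths 0, …, K - 1 fire in turn, leaving d - 1 chips at every
-- depth below K - 1, none at depth K - 1 and one more at depth K; if there is no such depth, all
-- levels fire and (d - 1, …, d - 1, 0) remains.  This is the lexicographic successor among recurrent
-- level vectors because in a recurrent configuration an empty level forces all shallower levels to be
-- full: otherwise, of the band of levels in between, the vertex toppling last while u + w stabilises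
-- to u would end with at least as many chips as it has neighbours in the band, which it cannot hold.

open import Defs

open import Data.Bool using (Bool; true; false; if_then_else_; T)
open import Data.Bool.Properties using (if-eta)
open import Data.Empty using (⊥-elim)
open import Data.Fin using (Fin; toℕ; fromℕ<)
import Data.Fin as Fin
open import Data.Fin.Permutation using (Permutation′; _⟨$⟩ʳ_; flip; inverseˡ; transpose)
import Data.Fin.Properties as Finₚ
open import Data.List using (List; []; _∷_; length; map; _++_; tabulate; replicate)
open import Data.List.Properties using (map-++; map-cong; map-∘; length-replicate; ∷-injective)
open import Data.Nat using (ℕ; zero; suc; pred; _+_; _*_; _∸_; _≤_; _<_; _>_; _≡ᵇ_; z≤n; s≤s; >-nonZero)
open import Data.Nat.ListAction using (sum)
open import Data.Nat.ListAction.Properties using (sum-++)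
open import Data.Nat.Properties
open import Algebra.Properties.CommutativeMonoid.Sum +-0-commutativeMonoid using (sum-syntax; sum-cong-≗)
open import Algebra.Properties.CommutativeSemigroup +-commutativeSemigroup using (xy∙z≈xz∙y; interchange)
open import Data.Product using (Σ; ∃; _×_; _,_; proj₁; proj₂)
open import Data.Sum using (_⊎_; inj₁; inj₂)
open import Data.Unit using (tt)
open import Function using (_∘_)
open import Function.Bundles using (_⇔_; mk⇔)
open import Relation.Binary.Definitions using (Tri; tri<; tri≈; tri>)
open import Relation.Binary.PropositionalEquality using (_≡_; _≢_; refl; sym; trans; cong; cong₂; subst; _≗_; module ≡-Reasoning)
open import Relation.Nullary using (¬_; yes; no; Dec)
open import Relation.Nullary.Decidable using (⌊_⌋; _×-dec_; isYes≗does; dec-true; dec-false; does-⇔)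
open import Relation.Unary using (Decidable)

⌊⌋-true : ∀ {a} {A : Set a} (a? : Dec A) → A → ⌊ a? ⌋ ≡ true
⌊⌋-true a? a = trans (isYes≗does a?) (dec-true a? a)

⌊⌋-false : ∀ {a} {A : Set a} (a? : Dec A) → ¬ A → ⌊ a? ⌋ ≡ false
⌊⌋-false a? ¬a = trans (isYes≗does a?) (dec-false a? ¬a)

⌊⌋-⇔ : ∀ {a b} {A : Set a} {B : Set b} → A ⇔ B → (a? : Dec A) (b? : Dec B) → ⌊ a? ⌋ ≡ ⌊ b? ⌋
⌊⌋-⇔ A⇔B a? b? = trans (isYes≗does a?) (trans (does-⇔ A⇔B a? b?) (sym (isYes≗does b?)))

module _ {a} {A : Set a} where

  sum-map-++ : ∀ (f : A → ℕ) xs ys → sum (map f (xs ++ ys)) ≡ sum (map f xs) + sum (map f ys)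
  sum-map-++ f xs ys = trans (cong sum (map-++ f xs ys)) (sum-++ (map f xs) (map f ys))

  sum-map-cong : ∀ {f g : A → ℕ} → f ≗ g → ∀ xs → sum (map f xs) ≡ sum (map g xs)
  sum-map-cong f≗g xs = cong sum (map-cong f≗g xs)

  sum-map-zero : ∀ {f : A → ℕ} → (∀ x → f x ≡ 0) → ∀ xs → sum (map f xs) ≡ 0
  sum-map-zero f≡0 []       = refl
  sum-map-zero f≡0 (x ∷ xs) = cong₂ _+_ (f≡0 x) (sum-map-zero f≡0 xs)

  sum-map-+ : ∀ (f g : A → ℕ) xs → sum (map (λ x → f x + g x) xs) ≡ sum (map f xs) + sum (map g xs)
  sum-map-+ f g []       = refl
  sum-map-+ f g (x ∷ xs) = trans (cong (f x + g x +_) (sum-map-+ f g xs))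
                                 (interchange (f x) (g x) (sum (map f xs)) (sum (map g xs)))

  sum-map-*ˡ : ∀ k (f : A → ℕ) xs → sum (map (λ x → k * f x) xs) ≡ k * sum (map f xs)
  sum-map-*ˡ k f []       = sym (*-zeroʳ k)
  sum-map-*ˡ k f (x ∷ xs) = trans (cong (k * f x +_) (sum-map-*ˡ k f xs)) (sym (*-distribˡ-+ k (f x) _))

  sum-map-mono : ∀ {f g : A → ℕ} → (∀ x → f x ≤ g x) → ∀ xs → sum (map f xs) ≤ sum (map g xs)
  sum-map-mono f≤g []       = z≤n
  sum-map-mono f≤g (x ∷ xs) = +-mono-≤ (f≤g x) (sum-map-mono f≤g xs)

  sum-map-tabulate : ∀ {k} (f : A → ℕ) (g : Fin k → A) → sum (map f (tabulate g)) ≡ ∑[ i < k ] f (g i)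
  sum-map-tabulate {zero}  f g = refl
  sum-map-tabulate {suc k} f g = cong (f (g Fin.zero) +_) (sum-map-tabulate f (g ∘ Fin.suc))

∑-zero : ∀ {k} (f : Fin k → ℕ) → (∀ i → f i ≡ 0) → ∑[ i < k ] f i ≡ 0
∑-zero {zero}  f f≡0 = refl
∑-zero {suc k} f f≡0 = cong₂ _+_ (f≡0 Fin.zero) (∑-zero (f ∘ Fin.suc) (f≡0 ∘ Fin.suc))

∑-const : ∀ k c → ∑[ i < k ] c ≡ k * c
∑-const zero    c = refl
∑-const (suc k) c = cong (c +_) (∑-const k c)

∑-δ : ∀ {k} (f : Fin k → ℕ) j → (∀ i → i ≢ j → f i ≡ 0) → ∑[ i < k ] f i ≡ f j
∑-δ f Fin.zero    off =
  trans (cong (f Fin.zero +_) (∑-zero (f ∘ Fin.suc) (λ i → off (Fin.suc i) λ ()))) (+-identityʳ (f Fin.zero))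
∑-δ f (Fin.suc j) off =
  cong₂ _+_ (off Fin.zero λ ()) (∑-δ (f ∘ Fin.suc) j (λ i i≢j → off (Fin.suc i) (i≢j ∘ Finₚ.suc-injective)))

≤-∑ : ∀ {k} (f : Fin k → ℕ) i → f i ≤ ∑[ j < k ] f j
≤-∑ f Fin.zero    = m≤m+n (f Fin.zero) _
≤-∑ f (Fin.suc i) = ≤-trans (≤-∑ (f ∘ Fin.suc) i) (m≤n+m _ (f Fin.zero))

module Toppling (d n : ℕ) where
  open Sandpile d n

  vertex-≡ : {v w : Vertex} → proj₁ v ≡ proj₁ w → v ≡ w
  vertex-≡ {p , l₁} {.p , l₂} refl = cong (p ,_) (≤-irrelevant l₁ l₂)

  sameV-refl : ∀ v → sameV v v ≡ true
  sameV-refl v = ⌊⌋-true (proj₁ v ≟L proj₁ v) refl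

  sameV-≢ : ∀ {v w} → proj₁ v ≢ proj₁ w → sameV v w ≡ false
  sameV-≢ {v} {w} v≢w = ⌊⌋-false (proj₁ v ≟L proj₁ w) v≢w

  sameV-≡ : ∀ {v w} → sameV v w ≡ true → v ≡ w
  sameV-≡ {v} {w} eq with proj₁ v ≟L proj₁ w
  ... | yes p = vertex-≡ p

  -- topple c v w is definitionally drain (sameV w v) (c w) + adj v w.
  drain : Bool → ℕ → ℕ
  drain b x = if b then x ∸ d else x

  drain-+ : ∀ b {x} y → (b ≡ true → d ≤ x) → drain b (x + y) ≡ drain b x + y
  drain-+ true  y d≤x = +-∸-comm y (d≤x refl)
  drain-+ false y _   = refl

  drain-comm : ∀ b b′ x → drain b (drain b′ x) ≡ drain b′ (drain b x)
  drain-comm true  true  x = refl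
  drain-comm true  false x = refl
  drain-comm false b′    x = refl

  topple-cong : ∀ {c c′} → c ≗ c′ → ∀ v → topple c v ≗ topple c′ v
  topple-cong c≗c′ v w = cong (λ x → drain (sameV w v) x + adj v w) (c≗c′ w)

  ≤-topple : ∀ c v w → sameV w v ≡ false → c w ≤ topple c v w
  ≤-topple c v w eq rewrite eq = m≤m+n (c w) (adj v w)

  topple-comm : ∀ c v v′ → d ≤ c v → d ≤ c v′ → proj₁ v ≢ proj₁ v′ →
    topple (topple c v) v′ ≗ topple (topple c v′) v
  topple-comm c v v′ d≤cv d≤cv′ v≢v′ w = begin
    drain b′ (drain b x + a) + a′   ≡⟨ cong (_+ a′) (drain-+ b′ a (unstable-after v v′ d≤cv′ (v≢v′ ∘ sym))) ⟩
    drain b′ (drain b x) + a + a′   ≡⟨ cong (λ y → y + a + a′) (drain-comm b′ b x) ⟩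
    drain b (drain b′ x) + a + a′   ≡⟨ xy∙z≈xz∙y (drain b (drain b′ x)) a a′ ⟩
    drain b (drain b′ x) + a′ + a   ≡⟨ cong (_+ a) (drain-+ b a′ (unstable-after v′ v d≤cv v≢v′)) ⟨
    drain b (drain b′ x + a′) + a   ∎
    where
    open ≡-Reasoning
    x = c w
    b = sameV w v
    b′ = sameV w v′
    a = adj v w
    a′ = adj v′ w
    unstable-after : ∀ u u′ → d ≤ c u′ → proj₁ u′ ≢ proj₁ u →
      sameV w u′ ≡ true → d ≤ drain (sameV w u) x
    unstable-after u u′ d≤cu′ u′≢u eq with sameV-≡ {w} {u′} eq
    ... | refl rewrite sameV-≢ {u′} {u} u′≢u = d≤cu′

  reach-congˡ : ∀ {c c′ s} → c ≗ c′ → Reach c s → Reach c′ s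
  reach-congˡ c≗c′ (done c≗s) = done (λ w → trans (sym (c≗c′ w)) (c≗s w))
  reach-congˡ c≗c′ (step v d≤cv r) =
    step v (subst (d ≤_) (c≗c′ v) d≤cv) (reach-congˡ (topple-cong c≗c′ v) r)

  reach-congʳ : ∀ {c s s′} → s ≗ s′ → Reach c s → Reach c s′
  reach-congʳ s≗s′ (done c≗s) = done (λ w → trans (c≗s w) (s≗s′ w))
  reach-congʳ s≗s′ (step v d≤cv r) = step v d≤cv (reach-congʳ s≗s′ r)

  reach-trans : ∀ {a b c} → Reach a b → Reach b c → Reach a c
  reach-trans (done a≗b) r = reach-congˡ (λ w → sym (a≗b w)) r
  reach-trans (step v d≤av r) r′ = step v d≤av (reach-trans r r′)

  -- A legal toppling commutes with the earlier steps of a stabilising sequence (topple-comm),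
  -- so it can be done first.
  reach-topple : ∀ {c s} → Reach c s → Stable s → ∀ v → d ≤ c v → Reach (topple c v) s
  reach-topple (done c≗s) st v d≤cv = ⊥-elim (<⇒≱ (st v) (subst (d ≤_) (c≗s v) d≤cv))
  reach-topple {c} {s} (step v′ d≤cv′ r) st v d≤cv with proj₁ v′ ≟L proj₁ v
  ... | yes v′≡v = reach-congˡ (λ w → cong (λ y → topple c y w) (vertex-≡ {v′} {v} v′≡v)) r
  ... | no v′≢v = step v′ d≤cv′-after (reach-congˡ (topple-comm c v′ v d≤cv′ d≤cv v′≢v) r-after)
    where
    d≤cv′-after : d ≤ topple c v v′
    d≤cv′-after = ≤-trans d≤cv′ (≤-topple c v v′ (sameV-≢ {v′} {v} v′≢v))
    r-after : Reach (topple (topple c v′) v) s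
    r-after = reach-topple r st v (≤-trans d≤cv (≤-topple c v′ v (sameV-≢ {v} {v′} (v′≢v ∘ sym))))

  stab-unique : ∀ {c s₁ s₂} → Stab c s₁ → Stab c s₂ → s₁ ≗ s₂
  stab-unique (done c≗s₁ , _) (done c≗s₂ , _) w = trans (sym (c≗s₁ w)) (c≗s₂ w)
  stab-unique (done c≗s₁ , st₁) (step v d≤cv _ , _) = ⊥-elim (<⇒≱ (st₁ v) (subst (d ≤_) (c≗s₁ v) d≤cv))
  stab-unique (step v d≤cv r , st₁) (r₂ , st₂) = stab-unique (r , st₁) (reach-topple r₂ st₂ v d≤cv , st₂)

  reach-resume : ∀ {c c′ s} → Stab c s → Reach c c′ → Reach c′ s
  reach-resume (r , st) (done c≗c′) = reach-congˡ c≗c′ r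
  reach-resume (r , st) (step v d≤cv r′) = reach-resume (reach-topple r st v d≤cv , st) r′

  topple-⊕ : ∀ c x v → d ≤ c v → topple c v ⊕ x ≗ topple (c ⊕ x) v
  topple-⊕ c x v d≤cv w = begin
    drain b (c w) + adj v w + x w   ≡⟨ xy∙z≈xz∙y (drain b (c w)) (adj v w) (x w) ⟩
    drain b (c w) + x w + adj v w   ≡⟨ cong (_+ adj v w) (drain-+ b (x w) d≤cw) ⟨
    drain b (c w + x w) + adj v w   ∎
    where
    open ≡-Reasoning
    b = sameV w v
    d≤cw : b ≡ true → d ≤ c w
    d≤cw eq = subst (λ y → d ≤ c y) (sym (sameV-≡ {w} {v} eq)) d≤cv

  reach-⊕ : ∀ {c s} x → Reach c s → Reach (c ⊕ x) (s ⊕ x)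
  reach-⊕ x (done c≗s) = done (λ w → cong (_+ x w) (c≗s w))
  reach-⊕ {c} x (step v d≤cv r) =
    step v (≤-trans d≤cv (m≤m+n (c v) (x v))) (reach-congˡ (topple-⊕ c x v d≤cv) (reach-⊕ x r))

  kδr-zero : ∀ w → kδr 0 w ≡ 0
  kδr-zero w = if-eta (length (proj₁ w) ≡ᵇ 0)

  kδr-suc : ∀ (c : Config) k → (c ⊕ kδr k) ⊕ kδr 1 ≗ c ⊕ kδr (suc k)
  kδr-suc c k w with length (proj₁ w) ≡ᵇ 0
  ... | true  = trans (+-assoc (c w) k 1) (cong (c w +_) (+-comm k 1))
  ... | false = +-identityʳ (c w + 0)

  reach-next-multiple : ∀ e k {s s′} → Reach (e ⊕ kδr k) s → Reach (s ⊕ kδr 1) s′ → Reach (e ⊕ kδr (suc k)) s′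
  reach-next-multiple e k r r′ = reach-trans (reach-congˡ (kδr-suc e k) (reach-⊕ (kδr 1) r)) r′

  stab-recurrent : ∀ {e x u} → Recurrent e → Stab (e ⊕ x) u → Recurrent u
  stab-recurrent {e} {x} {u} (_ , w , w≢0 , (r-e , _)) (r-u , st-u) =
    st-u , w , w≢0 , reach-resume (r-ewx , st-u) (reach-⊕ w r-u) , st-u
    where
    r-ewx : Reach ((e ⊕ x) ⊕ w) u
    r-ewx = reach-congˡ (λ y → xy∙z≈xz∙y (e y) (w y) (x y)) (reach-trans (reach-⊕ x r-e) r-u)

  topplings : ∀ {c s} → Reach c s → Vertex → ℕ
  topplings (done _)     y = 0
  topplings (step v _ r) y = b2n (sameV y v) + topplings r y

  drain-b2n : ∀ b x → drain b x ≡ x ∸ d * b2n b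
  drain-b2n true  x = cong (x ∸_) (sym (*-identityʳ d))
  drain-b2n false x = cong (x ∸_) (sym (*-zeroʳ d))

  count : List Vertex → Vertex → ℕ
  count S w = sum (map (λ v → b2n (sameV w v)) S)

  received : List Vertex → Vertex → ℕ
  received S w = sum (map (λ v → adj v w) S)

  fire : ∀ S c → (∀ w → d * count S w ≤ c w) → Reach c (λ w → c w ∸ d * count S w + received S w)
  fire []      c _     = done (λ w → sym (trans (+-identityʳ _) (cong (c w ∸_) (*-zeroʳ d))))
  fire (v ∷ S) c legal = step v d≤cv (reach-congʳ fired (fire S (topple c v) legal′))
    where
    room : ∀ w → d * count S w ≤ c w ∸ d * b2n (sameV w v)
    room w = m+n≤o⇒m≤o∸n (d * count S w) {d * b2n (sameV w v)}
      (subst (_≤ c w) (trans (*-distribˡ-+ d β D) (+-comm (d * β) (d * D))) (legal w))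
      where
      β = b2n (sameV w v)
      D = count S w
    d≤cv : d ≤ c v
    d≤cv = ≤-trans (m≤m*n d (suc (count S v)))
      (subst (λ b → d * (b2n b + count S v) ≤ c v) (sameV-refl v) (legal v))
    legal′ : ∀ w → d * count S w ≤ topple c v w
    legal′ w = ≤-trans (room w) (subst (_≤ topple c v w) (drain-b2n (sameV w v) (c w)) (m≤m+n _ (adj v w)))
    fired : ∀ w → topple c v w ∸ d * count S w + received S w
                ≡ c w ∸ d * count (v ∷ S) w + received (v ∷ S) w
    fired w = begin
      drain b x + a ∸ d * D + N     ≡⟨ cong (λ y → y + a ∸ d * D + N) (drain-b2n b x) ⟩
      x ∸ d * β + a ∸ d * D + N     ≡⟨ cong (_+ N) (+-∸-comm a (room w)) ⟩
      x ∸ d * β ∸ d * D + a + N     ≡⟨ cong (λ y → y + a + N) (∸-+-assoc x (d * β) (d * D)) ⟩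
      x ∸ (d * β + d * D) + a + N   ≡⟨ cong (λ y → x ∸ y + a + N) (*-distribˡ-+ d β D) ⟨
      x ∸ d * (β + D) + a + N       ≡⟨ +-assoc (x ∸ d * (β + D)) a N ⟩
      x ∸ d * (β + D) + (a + N)     ∎
      where
      open ≡-Reasoning
      x = c w
      b = sameV w v
      β = b2n b
      a = adj v w
      D = count S w
      N = received S w

module Relabelling (d n : ℕ) where
  open Sandpile d n
  open Toppling d n

  Path : Set
  Path = List (Fin (d ∸ 1))

  LevelPermutation : Set
  LevelPermutation = ℕ → Permutation′ (d ∸ 1)

  _⁻¹ : LevelPermutation → LevelPermutation
  (π ⁻¹) t = flip (π t)

  relabel : LevelPermutation → Path → Path
  relabel π []      = []
  relabel π (i ∷ p) = (π (length p) ⟨$⟩ʳ i) ∷ relabel π p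

  length-relabel : ∀ π p → length (relabel π p) ≡ length p
  length-relabel π []      = refl
  length-relabel π (i ∷ p) = cong suc (length-relabel π p)

  relabel-inverse : ∀ π p → relabel (π ⁻¹) (relabel π p) ≡ p
  relabel-inverse π []      = refl
  relabel-inverse π (i ∷ p) rewrite length-relabel π p =
    cong₂ _∷_ (inverseˡ (π (length p))) (relabel-inverse π p)

  relabel-injective : ∀ π {p q} → relabel π p ≡ relabel π q → p ≡ q
  relabel-injective π {p} {q} eq =
    trans (sym (relabel-inverse π p)) (trans (cong (relabel (π ⁻¹)) eq) (relabel-inverse π q))

  ≟L-relabel : ∀ π p q → ⌊ relabel π p ≟L relabel π q ⌋ ≡ ⌊ p ≟L q ⌋
  ≟L-relabel π p q = ⌊⌋-⇔ (mk⇔ (relabel-injective π) (cong (relabel π))) _ _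

  isChildOf-relabel : ∀ π p q → isChildOf (relabel π p) (relabel π q) ≡ isChildOf p q
  isChildOf-relabel π []      q = refl
  isChildOf-relabel π (i ∷ p) q = ≟L-relabel π p q

  relabelV : LevelPermutation → Vertex → Vertex
  relabelV π (p , lt) = relabel π p , subst (_< n ∸ 1) (sym (length-relabel π p)) lt

  relabelV-inverse : ∀ π v → relabelV (π ⁻¹) (relabelV π v) ≡ v
  relabelV-inverse π (p , _) = vertex-≡ (relabel-inverse π p)

  module _ (π : LevelPermutation) where
    private
      ψ = relabelV π
      ψ⁻¹ = relabelV (π ⁻¹)

    topple-relabel : ∀ c v → topple (c ∘ ψ) v ≗ topple c (ψ v) ∘ ψ
    topple-relabel c (p , _) (q , _)
      rewrite ≟L-relabel π q p | isChildOf-relabel π p q | isChildOf-relabel π q p = refl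

    reach-relabel : ∀ {c s} → Reach c s → Reach (c ∘ ψ) (s ∘ ψ)
    reach-relabel (done c≗s) = done (c≗s ∘ ψ)
    reach-relabel {c} (step v d≤cv r) =
      step (ψ⁻¹ v) (subst (λ y → d ≤ c y) (sym (relabelV-inverse (π ⁻¹) v)) d≤cv)
        (reach-congˡ toppled (reach-relabel r))
      where
      toppled : topple c v ∘ ψ ≗ topple (c ∘ ψ) (ψ⁻¹ v)
      toppled w = trans (cong (λ y → topple c y (ψ w)) (sym (relabelV-inverse (π ⁻¹) v)))
                        (sym (topple-relabel c (ψ⁻¹ v) w))

    stab-relabel : ∀ {c s} → Stab c s → Stab (c ∘ ψ) (s ∘ ψ)
    stab-relabel (r , st) = reach-relabel r , st ∘ ψ

    recurrent-relabel : ∀ {u} → Recurrent u → Recurrent (u ∘ ψ)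
    recurrent-relabel (st , w , w≢0 , s) = st ∘ ψ , w ∘ ψ , wψ≢0 , stab-relabel s
      where
      wψ≢0 : ¬ (∀ y → w (ψ y) ≡ 0)
      wψ≢0 wψ≡0 = w≢0 (λ y → subst (λ z → w z ≡ 0) (relabelV-inverse (π ⁻¹) y) (wψ≡0 (ψ⁻¹ y)))

  -- Both e ∘ ψ and e are (e ⊕ e ∘ ψ)°: the first because e is the identity, the second by
  -- transporting (e ⊕ e ∘ ψ⁻¹)° = e ∘ ψ⁻¹ along ψ.
  identity-relabel : ∀ {e} → IsIdentity e → ∀ π → e ∘ relabelV π ≗ e
  identity-relabel {e} (rec , absorbs) π w = trans (stab-unique s₁ s₂ w) (cong e (relabelV-inverse π w))
    where
    ψ = relabelV π
    s₁ : Stab (e ⊕ (e ∘ ψ)) (e ∘ ψ)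
    s₁ = absorbs (e ∘ ψ) (recurrent-relabel π rec)
    s₂ : Stab (e ⊕ (e ∘ ψ)) (e ∘ relabelV (π ⁻¹) ∘ ψ)
    s₂ with stab-relabel π (absorbs (e ∘ relabelV (π ⁻¹)) (recurrent-relabel (π ⁻¹) rec))
    ... | r , st = reach-congˡ swap r , st
      where
      swap : ∀ y → e (ψ y) + e (relabelV (π ⁻¹) (ψ y)) ≡ e y + e (ψ y)
      swap y = trans (+-comm (e (ψ y)) _) (cong (λ z → e z + e (ψ y)) (relabelV-inverse π y))

module WiredTree (m′ n′ : ℕ) where
  m d n : ℕ
  m = suc m′
  d = suc m
  n = suc (suc n′)

  open Sandpile d n
  open Toppling d n
  open Relabelling d n

  depth-length : ∀ w → toℕ (depth w) ≡ length (proj₁ w)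
  depth-length (p , lt) = Finₚ.toℕ-fromℕ< lt

  entry : Path → ℕ → Fin m
  entry []      t = Fin.zero
  entry (i ∷ p) t with t ≟ length p
  ... | yes _ = i
  ... | no _  = entry p t

  straighten : Path → LevelPermutation
  straighten p t = transpose (entry p t) Fin.zero

  transpose-self : ∀ (i : Fin m) → transpose i Fin.zero ⟨$⟩ʳ i ≡ Fin.zero
  transpose-self i rewrite dec-true (i Fin.≟ i) refl = refl

  relabel-straighten : ∀ p q → (∀ t → t < length q → entry p t ≡ entry q t) →
    relabel (straighten p) q ≡ replicate (length q) Fin.zero
  relabel-straighten p []      _      = refl
  relabel-straighten p (i ∷ q) agrees = cong₂ _∷_ head-zero (relabel-straighten p q agrees-tail)
    where
    head-zero : transpose (entry p (length q)) Fin.zero ⟨$⟩ʳ i ≡ Fin.zero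
    head-zero with agrees (length q) ≤-refl
    ... | eq with length q ≟ length q
    ...   | yes _ rewrite eq = transpose-self i
    ...   | no q≢q = ⊥-elim (q≢q refl)
    agrees-tail : ∀ t → t < length q → entry p t ≡ entry q t
    agrees-tail t t<q with agrees t (m<n⇒m<1+n t<q)
    ... | eq with t ≟ length q
    ...   | yes refl = ⊥-elim (<-irrefl refl t<q)
    ...   | no _ = eq

  spine : Fin (n ∸ 1) → Vertex
  spine t = replicate (toℕ t) Fin.zero , subst (_< n ∸ 1) (sym (length-replicate (toℕ t))) (Finₚ.toℕ<n t)

  depth-spine : ∀ t → depth (spine t) ≡ t
  depth-spine t = Finₚ.toℕ-injective (trans (depth-length (spine t)) (length-replicate (toℕ t)))

  identity-level : ∀ {e} → IsIdentity e → ∀ w → e w ≡ e (spine (depth w))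
  identity-level {e} isId w@(p , lt) = trans (sym (identity-relabel isId (straighten p) w)) (cong e (vertex-≡ straight))
    where
    straight : relabel (straighten p) p ≡ replicate (toℕ (fromℕ< lt)) Fin.zero
    straight = trans (relabel-straighten p p (λ _ _ → refl))
                     (cong (λ k → replicate k Fin.zero) (sym (Finₚ.toℕ-fromℕ< lt)))

  ≟L-sym : ∀ p q → ⌊ p ≟L q ⌋ ≡ ⌊ q ≟L p ⌋
  ≟L-sym p q = ⌊⌋-⇔ (mk⇔ sym sym) (p ≟L q) (q ≟L p)

  ≟L-∷ : ∀ i p q → ⌊ (i ∷ p) ≟L (i ∷ q) ⌋ ≡ ⌊ p ≟L q ⌋
  ≟L-∷ i p q = ⌊⌋-⇔ (mk⇔ (proj₂ ∘ ∷-injective) (cong (i ∷_))) ((i ∷ p) ≟L (i ∷ q)) (p ≟L q)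

  ≟L-∷-≢ : ∀ {i j} p q → i ≢ j → ⌊ (i ∷ p) ≟L (j ∷ q) ⌋ ≡ false
  ≟L-∷-≢ {i} {j} p q i≢j = ⌊⌋-false ((i ∷ p) ≟L (j ∷ q)) (i≢j ∘ proj₁ ∘ ∷-injective)

  ∑-≟L-∷ : ∀ j p q → ∑[ i < m ] b2n ⌊ (j ∷ p) ≟L (i ∷ q) ⌋ ≡ b2n ⌊ p ≟L q ⌋
  ∑-≟L-∷ j p q =
    trans (∑-δ (λ i → b2n ⌊ (j ∷ p) ≟L (i ∷ q) ⌋) j (λ i i≢j → cong b2n (≟L-∷-≢ p q (i≢j ∘ sym))))
          (cong b2n (≟L-∷ j p q))

  m*b2n : ∀ b → m * b2n b ≡ (if b then m else 0)
  m*b2n true  = *-identityʳ m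
  m*b2n false = *-zeroʳ m

  PathOfLength : ℕ → Set
  PathOfLength l = Σ Path (λ p → length p ≡ l)

  extend : ∀ {l} → List (PathOfLength l) → List (PathOfLength (suc l))
  extend []             = []
  extend ((p , eq) ∷ ps) = tabulate (λ i → i ∷ p , cong suc eq) ++ extend ps

  pathsOfLength : (l : ℕ) → List (PathOfLength l)
  pathsOfLength zero    = ([] , refl) ∷ []
  pathsOfLength (suc l) = extend (pathsOfLength l)

  sum-extend : ∀ {l} (g : Path → ℕ) (ps : List (PathOfLength l)) →
    sum (map (g ∘ proj₁) (extend ps)) ≡ sum (map (λ pe → ∑[ i < m ] g (i ∷ proj₁ pe)) ps)
  sum-extend g []             = refl
  sum-extend g ((p , eq) ∷ ps) =
    trans (sum-map-++ (g ∘ proj₁) (tabulate (λ i → i ∷ p , cong suc eq)) (extend ps))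
          (cong₂ _+_ (sum-map-tabulate (g ∘ proj₁) (λ i → i ∷ p , cong suc eq)) (sum-extend g ps))

  count-pathsOfLength : ∀ l q →
    sum (map (λ pe → b2n ⌊ q ≟L proj₁ pe ⌋) (pathsOfLength l)) ≡ b2n (length q ≡ᵇ l)
  count-pathsOfLength zero    []      = refl
  count-pathsOfLength zero    (j ∷ q) = refl
  count-pathsOfLength (suc l) []      =
    trans (sum-extend (λ p → b2n ⌊ [] ≟L p ⌋) (pathsOfLength l))
          (sum-map-zero (λ pe → ∑-zero {m} (λ i → b2n ⌊ [] ≟L (i ∷ proj₁ pe) ⌋) (λ _ → refl))
                        (pathsOfLength l))
  count-pathsOfLength (suc l) (j ∷ q) =
    trans (sum-extend (λ p → b2n ⌊ (j ∷ q) ≟L p ⌋) (pathsOfLength l))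
          (trans (sum-map-cong (λ pe → ∑-≟L-∷ j q (proj₁ pe)) (pathsOfLength l)) (count-pathsOfLength l q))

  count-parentsOfLength : ∀ l q →
    sum (map (λ pe → b2n (isChildOf q (proj₁ pe))) (pathsOfLength l)) ≡ b2n (length q ≡ᵇ suc l)
  count-parentsOfLength l []      = sum-map-zero (λ _ → refl) (pathsOfLength l)
  count-parentsOfLength l (j ∷ q) = count-pathsOfLength l q

  count-childrenOfLength : ∀ l q → sum (map (λ pe → b2n (isChildOf (proj₁ pe) q)) (pathsOfLength l))
                           ≡ (if suc (length q) ≡ᵇ l then m else 0)
  count-childrenOfLength zero    q = refl
  count-childrenOfLength (suc l) q = begin
    sum (map (λ pe → b2n (isChildOf (proj₁ pe) q)) (extend (pathsOfLength l)))
      ≡⟨ sum-extend (λ p → b2n (isChildOf p q)) (pathsOfLength l) ⟩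
    sum (map (λ pe → ∑[ i < m ] b2n ⌊ proj₁ pe ≟L q ⌋) (pathsOfLength l))
      ≡⟨ sum-map-cong (λ pe → trans (∑-const m _) (cong (λ b → m * b2n b) (≟L-sym (proj₁ pe) q)))
                      (pathsOfLength l) ⟩
    sum (map (λ pe → m * b2n ⌊ q ≟L proj₁ pe ⌋) (pathsOfLength l))
      ≡⟨ sum-map-*ˡ m _ (pathsOfLength l) ⟩
    m * sum (map (λ pe → b2n ⌊ q ≟L proj₁ pe ⌋) (pathsOfLength l))
      ≡⟨ cong (m *_) (count-pathsOfLength l q) ⟩
    m * b2n (length q ≡ᵇ l)
      ≡⟨ m*b2n (length q ≡ᵇ l) ⟩
    (if length q ≡ᵇ l then m else 0) ∎
    where open ≡-Reasoning

  level : (l : ℕ) → l < n ∸ 1 → List Vertex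
  level l lt = map (λ (p , eq) → p , subst (_< n ∸ 1) (sym eq) lt) (pathsOfLength l)

  count-level : ∀ l lt w → count (level l lt) w ≡ b2n (length (proj₁ w) ≡ᵇ l)
  count-level l lt w = trans (cong sum (sym (map-∘ (pathsOfLength l)))) (count-pathsOfLength l (proj₁ w))

  received-level : ∀ l lt w → received (level l lt) w
    ≡ b2n (length (proj₁ w) ≡ᵇ suc l) + (if suc (length (proj₁ w)) ≡ᵇ l then m else 0)
  received-level l lt (q , _) =
    trans (cong sum (sym (map-∘ (pathsOfLength l))))
      (trans (sum-map-+ (λ pe → b2n (isChildOf q (proj₁ pe))) (λ pe → b2n (isChildOf (proj₁ pe) q)) (pathsOfLength l))
        (cong₂ _+_ (count-parentsOfLength l q) (count-childrenOfLength l q)))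

  firedLevel : ℕ → ℕ → ℕ → ℕ
  firedLevel l t x = drain (t ≡ᵇ l) x + (b2n (t ≡ᵇ suc l) + (if suc t ≡ᵇ l then m else 0))

  fire-level : ∀ (b : LevelVec) L → d ≤ b L →
    Reach (levelConfig b) (levelConfig (λ t → firedLevel (toℕ L) (toℕ t) (b t)))
  fire-level b L d≤bL = reach-congʳ fired (fire (level l lt) (levelConfig b) legal)
    where
    l = toℕ L
    lt = Finₚ.toℕ<n L
    legal : ∀ w → d * count (level l lt) w ≤ b (depth w)
    legal w rewrite count-level l lt w with length (proj₁ w) ≡ᵇ l in at-l
    ... | false = subst (_≤ b (depth w)) (sym (*-zeroʳ d)) z≤n
    ... | true  = subst (_≤ b (depth w)) (sym (*-identityʳ d)) (subst (λ t → d ≤ b t) (sym depth≡L) d≤bL)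
      where
      depth≡L : depth w ≡ L
      depth≡L = Finₚ.toℕ-injective (trans (depth-length w) (≡ᵇ⇒≡ _ _ (subst T (sym at-l) tt)))
    fired : ∀ w → b (depth w) ∸ d * count (level l lt) w + received (level l lt) w
                  ≡ firedLevel l (toℕ (depth w)) (b (depth w))
    fired w rewrite count-level l lt w | received-level l lt w | depth-length w =
      cong (_+ _) (sym (drain-b2n (length (proj₁ w) ≡ᵇ l) (b (depth w))))

  -- Chips at depth t (initially x) once a chip has been added at the root and depths 0, …, j-1
  -- have fired in turn: depths below j-1 hold m, depth j-1 is empty, depth j gained one chip.
  afterCascade : ℕ → ℕ → ℕ → ℕ
  afterCascade zero          zero    x = suc x
  afterCascade zero          (suc t) x = x
  afterCascade (suc j)       (suc t) x = afterCascade j t x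
  afterCascade (suc zero)    zero    x = 0
  afterCascade (suc (suc j)) zero    x = m

  cascade-step : ∀ j t x → (t ≡ j → x ≡ m) → firedLevel j t (afterCascade j t x) ≡ afterCascade (suc j) t x
  cascade-step zero          zero          x x≡m rewrite x≡m refl = trans (+-identityʳ (m ∸ m)) (n∸n≡0 m)
  cascade-step zero          (suc zero)    x _   = +-comm x 1
  cascade-step zero          (suc (suc t)) x _   = +-identityʳ x
  cascade-step (suc zero)    zero          x _   = refl
  cascade-step (suc (suc j)) zero          x _   = +-identityʳ m
  cascade-step (suc j)       (suc t)       x x≡m = cascade-step j t x (x≡m ∘ cong suc)

  afterCascade-above : ∀ j t x → j < t → afterCascade j t x ≡ x
  afterCascade-above zero    (suc t) x _         = refl
  afterCascade-above (suc j) (suc t) x (s≤s j<t) = afterCascade-above j t x j<t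

  afterCascade-at : ∀ j x → afterCascade j j x ≡ suc x
  afterCascade-at zero    x = refl
  afterCascade-at (suc j) x = afterCascade-at j x

  afterCascade-emptied : ∀ t x → afterCascade (suc t) t x ≡ 0
  afterCascade-emptied zero    x = refl
  afterCascade-emptied (suc t) x = afterCascade-emptied t x

  afterCascade-full : ∀ j t x → suc t < j → afterCascade j t x ≡ m
  afterCascade-full (suc (suc j)) zero    x _         = refl
  afterCascade-full (suc j)       (suc t) x (s≤s t<j) = afterCascade-full j t x t<j

  afterCascade-below : ∀ j t x → t < j → afterCascade j t x ≤ m
  afterCascade-below j t x t<j with m≤n⇒m<n∨m≡n t<j
  ... | inj₁ st<j = ≤-reflexive (afterCascade-full j t x st<j)
  ... | inj₂ refl = subst (_≤ m) (sym (afterCascade-emptied t x)) z≤n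

  afterCascade-last : ∀ j t x → t < suc j → afterCascade (suc j) t x ≡ (if t ≡ᵇ j then 0 else m)
  afterCascade-last zero    zero    x _         = refl
  afterCascade-last (suc j) zero    x _         = refl
  afterCascade-last zero    (suc t) x (s≤s ())
  afterCascade-last (suc j) (suc t) x (s≤s t<j) = afterCascade-last j t x t<j

  cascaded : LevelVec → ℕ → LevelVec
  cascaded a j t = afterCascade j (toℕ t) (a t)

  root-chip : ∀ a → levelConfig a ⊕ kδr 1 ≗ levelConfig (cascaded a 0)
  root-chip a w = trans (chip (length (proj₁ w)) (a (depth w)))
                        (cong (λ t → afterCascade 0 t (a (depth w))) (sym (depth-length w)))
    where
    chip : ∀ t x → x + (if t ≡ᵇ 0 then 1 else 0) ≡ afterCascade 0 t x
    chip zero    x = +-comm x 1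
    chip (suc t) x = +-identityʳ x

  cascade : ∀ a j → j ≤ n ∸ 1 → (∀ t → toℕ t < j → a t ≡ m) →
    Reach (levelConfig a ⊕ kδr 1) (levelConfig (cascaded a j))
  cascade a zero    _  _    = done (root-chip a)
  cascade a (suc j) lt full =
    reach-trans (cascade a j (<⇒≤ lt) (λ t t<j → full t (m<n⇒m<1+n t<j)))
                (reach-congʳ (stepped ∘ depth) (fire-level (cascaded a j) J unstable))
    where
    J = fromℕ< lt
    toℕJ : toℕ J ≡ j
    toℕJ = Finₚ.toℕ-fromℕ< lt
    unstable : d ≤ cascaded a j J
    unstable rewrite toℕJ | afterCascade-at j (a J) | full J (subst (_< suc j) (sym toℕJ) ≤-refl) = ≤-refl
    stepped : ∀ t → firedLevel (toℕ J) (toℕ t) (cascaded a j t) ≡ cascaded a (suc j) t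
    stepped t rewrite toℕJ = cascade-step j (toℕ t) (a t) (λ t≡j → full t (subst (_< suc j) (sym t≡j) ≤-refl))

  parent : Vertex → List Vertex
  parent ([]    , _)  = []
  parent (i ∷ q , lt) = (q , <-trans (n<1+n (length q)) lt) ∷ []

  children : Vertex → List Vertex
  children (q , _) with suc (length q) <? n ∸ 1
  ... | yes lt = tabulate (λ i → i ∷ q , lt)
  ... | no _   = []

  neighbours : Vertex → List Vertex
  neighbours x = parent x ++ children x

  count-parent : ∀ v x → sum (map (λ y → b2n (sameV y v)) (parent x)) ≡ b2n (isChildOf (proj₁ x) (proj₁ v))
  count-parent v ([]    , _) = refl
  count-parent v (i ∷ q , _) = +-identityʳ _

  count-children : ∀ v x → sum (map (λ y → b2n (sameV y v)) (children x)) ≡ b2n (isChildOf (proj₁ v) (proj₁ x))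
  count-children (p , ltp) (q , _) with suc (length q) <? n ∸ 1
  ... | yes lt = trans (sum-map-tabulate (λ y → b2n (sameV y (p , ltp))) (λ i → i ∷ q , lt)) (∑-child p)
    where
    ∑-child : ∀ p → ∑[ i < m ] b2n ⌊ (i ∷ q) ≟L p ⌋ ≡ b2n (isChildOf p q)
    ∑-child []      = ∑-zero (λ i → b2n ⌊ (i ∷ q) ≟L [] ⌋) (λ _ → refl)
    ∑-child (j ∷ p) = trans (sum-cong-≗ (λ i → cong b2n (≟L-sym (i ∷ q) (j ∷ p)))) (∑-≟L-∷ j p q)
  ... | no ¬lt = sym (cong b2n (not-child p ltp))
    where
    not-child : ∀ p → length p < n ∸ 1 → isChildOf p q ≡ false
    not-child []      _   = refl
    not-child (j ∷ p) ltp = ⌊⌋-false (p ≟L q) (λ { refl → ¬lt ltp })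

  count-neighbours : ∀ v x → sum (map (λ y → b2n (sameV y v)) (neighbours x)) ≡ adj v x
  count-neighbours v x = trans (sum-map-++ _ (parent x) (children x)) (cong₂ _+_ (count-parent v x) (count-children v x))

  b2n≡0 : ∀ b → b2n b ≡ 0 → b ≡ false
  b2n≡0 false _ = refl

  unfired-final : ∀ {c s} (D : Reach c s) x → topplings D x ≡ 0 →
    s x ≡ c x + sum (map (topplings D) (neighbours x))
  unfired-final {c} (done c≗s) x _ =
    trans (sym (c≗s x)) (sym (trans (cong (c x +_) (sum-map-zero (λ _ → refl) (neighbours x))) (+-identityʳ (c x))))
  unfired-final {c} {s} (step v d≤cv r) x unfired = begin
    s x                                 ≡⟨ unfired-final r x (m+n≡0⇒n≡0 (b2n (sameV x v)) unfired) ⟩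
    topple c v x + N                    ≡⟨ cong (_+ N) toppled ⟩
    c x + adj v x + N                   ≡⟨ +-assoc (c x) (adj v x) N ⟩
    c x + (adj v x + N)                 ≡⟨ cong (λ k → c x + (k + N)) (count-neighbours v x) ⟨
    c x + (sum (map hit (neighbours x)) + N)
      ≡⟨ cong (c x +_) (sum-map-+ hit (topplings r) (neighbours x)) ⟨
    c x + sum (map (topplings (step v d≤cv r)) (neighbours x)) ∎
    where
    open ≡-Reasoning
    N = sum (map (topplings r) (neighbours x))
    hit = λ y → b2n (sameV y v)
    toppled : topple c v x ≡ c x + adj v x
    toppled rewrite b2n≡0 (sameV x v) (m+n≡0⇒m≡0 (b2n (sameV x v)) unfired) = refl

  root : Vertex
  root = [] , s≤s z≤n

  module _ {u w : Config} (D : Reach (u ⊕ w) u) where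
    private
      Unfired : Vertex → Set
      Unfired y = topplings D y ≡ 0

      unfired-path : ∀ {p lt lt′} → Unfired (p , lt) → Unfired (p , lt′)
      unfired-path = subst Unfired (vertex-≡ refl)

    unfired-isolated : ∀ y → Unfired y → w y ≡ 0 × sum (map (topplings D) (neighbours y)) ≡ 0
    unfired-isolated y unfired = m+n≡0⇒m≡0 (w y) nothing-arrives , m+n≡0⇒n≡0 (w y) nothing-arrives
      where
      nothing-arrives : w y + sum (map (topplings D) (neighbours y)) ≡ 0
      nothing-arrives = +-cancelˡ-≡ (u y) _ 0
        (trans (sym (+-assoc (u y) (w y) _)) (trans (sym (unfired-final D y unfired)) (sym (+-identityʳ (u y)))))

    unfired-parent : ∀ i q lt lt′ → Unfired (i ∷ q , lt) → Unfired (q , lt′)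
    unfired-parent i q lt lt′ unfired =
      unfired-path (m+n≡0⇒m≡0 _ (proj₂ (unfired-isolated (i ∷ q , lt) unfired)))

    unfired-child : ∀ q lt → Unfired (q , lt) → ∀ i lt′ → Unfired (i ∷ q , lt′)
    unfired-child q lt unfired i lt′ with suc (length q) <? n ∸ 1 | proj₂ (unfired-isolated (q , lt) unfired)
    ... | yes lt″ | none =
      unfired-path (n≤0⇒n≡0 (≤-trans (≤-∑ (λ j → topplings D (j ∷ q , lt″)) i) (≤-reflexive at-children)))
      where
      at-children : ∑[ j < m ] topplings D (j ∷ q , lt″) ≡ 0
      at-children = trans (sym (sum-map-tabulate (topplings D) (λ j → j ∷ q , lt″)))
        (m+n≡0⇒n≡0 (sum (map (topplings D) (parent (q , lt))))
                   (trans (sym (sum-map-++ (topplings D) (parent (q , lt)) _)) none))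
    ... | no ¬lt  | _    = ⊥-elim (¬lt lt′)

    unfired-root : ∀ p lt → Unfired (p , lt) → Unfired root
    unfired-root []      lt unfired = unfired-path unfired
    unfired-root (i ∷ q) lt unfired = unfired-root q lt′ (unfired-parent i q lt lt′ unfired)
      where lt′ = <-trans (n<1+n (length q)) lt

    unfired-everywhere : Unfired root → ∀ p lt → Unfired (p , lt)
    unfired-everywhere unfired []      lt = unfired-path unfired
    unfired-everywhere unfired (i ∷ q) lt =
      unfired-child q lt′ (unfired-everywhere unfired q lt′) i lt
      where lt′ = <-trans (n<1+n (length q)) lt

    all-topple : ¬ (∀ y → w y ≡ 0) → ∀ y → topplings D y ≢ 0
    all-topple w≢0 (p , lt) unfired = w≢0 λ (q , lt′) →
      proj₁ (unfired-isolated (q , lt′) (unfired-everywhere (unfired-root p lt unfired) q lt′))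

  adj-self : ∀ v → adj v v ≡ 0
  adj-self ([]    , _) = refl
  adj-self (i ∷ q , _) rewrite ⌊⌋-false (q ≟L (i ∷ q)) (λ eq → <-irrefl (cong length eq) (n<1+n (length q))) = refl

  -- After the first toppling of a vertex v ∈ P that is its last one, every neighbour of v in P still
  -- topples and sends v a chip.
  last-toppler : ∀ {c s} (D : Reach c s) {P : Vertex → Set} (P? : Decidable P) →
    (∀ y → P y → topplings D y ≢ 0) → ∀ {x₀} → P x₀ →
    ∃ λ x → P x × sum (map (λ y → b2n ⌊ P? y ⌋) (neighbours x)) ≤ s x
  last-toppler (done _) P? fires p₀ = ⊥-elim (fires _ p₀ refl)
  last-toppler {c} {s} (step v d≤cv r) {P} P? fires p₀ with P? v ×-dec (topplings r v ≟ 0)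
  ... | no ¬last = last-toppler r P? fires-later p₀
    where
    fires-later : ∀ y → P y → topplings r y ≢ 0
    fires-later y py unfired with sameV y v in y≟v
    ... | true  = ¬last (subst P y≡v py , subst (λ x → topplings r x ≡ 0) y≡v unfired)
      where y≡v = sameV-≡ {y} {v} y≟v
    ... | false = fires y py (trans (cong (λ b → b2n b + topplings r y) y≟v) unfired)
  ... | yes (pv , final) = v , pv , bound
    where
    Σr = sum (map (topplings r) (neighbours v))
    marked≤fired : ∀ y → b2n ⌊ P? y ⌋ ≤ topplings (step v d≤cv r) y
    marked≤fired y with P? y
    ... | no _   = z≤n
    ... | yes py = n≢0⇒n>0 (fires y py)
    fired : sum (map (topplings (step v d≤cv r)) (neighbours v)) ≡ Σr
    fired = trans (sum-map-+ (λ y → b2n (sameV y v)) (topplings r) (neighbours v))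
                  (cong (_+ Σr) (trans (count-neighbours v v) (adj-self v)))
    bound : sum (map (λ y → b2n ⌊ P? y ⌋) (neighbours v)) ≤ s v
    bound = ≤-trans (sum-map-mono marked≤fired (neighbours v))
              (≤-trans (≤-reflexive fired)
                (≤-trans (m≤n+m Σr (topple c v v)) (≤-reflexive (sym (unfired-final r v final)))))

  InBand : ℕ → ℕ → Vertex → Set
  InBand I J y = I ≤ length (proj₁ y) × length (proj₁ y) ≤ J

  inBand? : ∀ I J → Decidable (InBand I J)
  inBand? I J y = (I ≤? length (proj₁ y)) ×-dec (length (proj₁ y) ≤? J)

  inBand-neighbours : ℕ → ℕ → Vertex → ℕ
  inBand-neighbours I J x = sum (map (λ y → b2n ⌊ inBand? I J y ⌋) (neighbours x))

  parent-inBand : ∀ {I J} x → I < length (proj₁ x) → length (proj₁ x) ≤ J →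
    1 ≤ sum (map (λ y → b2n ⌊ inBand? I J y ⌋) (parent x))
  parent-inBand {I} {J} (i ∷ q , lt) (s≤s I≤q) q<J
    rewrite ⌊⌋-true (inBand? I J (q , <-trans (n<1+n (length q)) lt)) (I≤q , ≤-trans (n≤1+n _) q<J) = s≤s z≤n

  children-inBand : ∀ {I J} x → I ≤ length (proj₁ x) → length (proj₁ x) < J → J < n ∸ 1 →
    m ≤ sum (map (λ y → b2n ⌊ inBand? I J y ⌋) (children x))
  children-inBand {I} {J} (q , _) I≤q q<J J<n with suc (length q) <? n ∸ 1
  ... | yes lt = ≤-reflexive (sym (begin
    sum (map (λ y → b2n ⌊ inBand? I J y ⌋) (tabulate (λ i → i ∷ q , lt)))
      ≡⟨ sum-map-tabulate (λ y → b2n ⌊ inBand? I J y ⌋) (λ i → i ∷ q , lt) ⟩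
    ∑[ i < m ] b2n ⌊ inBand? I J (i ∷ q , lt) ⌋
      ≡⟨ sum-cong-≗ (λ i → cong b2n (⌊⌋-true (inBand? I J (i ∷ q , lt)) (≤-trans I≤q (n≤1+n _) , q<J))) ⟩
    ∑[ i < m ] 1
      ≡⟨ trans (∑-const m 1) (*-identityʳ m) ⟩
    m ∎))
    where open ≡-Reasoning
  ... | no ¬lt = ⊥-elim (¬lt (≤-<-trans q<J J<n))

  stable-levels : ∀ {c} → Stable (levelConfig c) → ∀ t → c t < d
  stable-levels {c} stable t = subst (λ t → c t < d) (depth-spine t) (stable (spine t))

  inBand-neighbours-exceed : ∀ {c} → (∀ t → c t < d) → ∀ P i → c P ≡ 0 → c i < m → toℕ i < toℕ P →
    ∀ x → InBand (toℕ i) (toℕ P) x → c (depth x) < inBand-neighbours (toℕ i) (toℕ P) x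
  inBand-neighbours-exceed {c} stable P i cP≡0 ci<m i<P x (I≤l , l≤J) = by-level (<-cmp l J) (<-cmp I l)
    where
    I = toℕ i
    J = toℕ P
    l = length (proj₁ x)
    at : ∀ {t} → l ≡ toℕ t → depth x ≡ t
    at l≡t = Finₚ.toℕ-injective (trans (depth-length x) l≡t)
    split : inBand-neighbours I J x
            ≡ sum (map (λ y → b2n ⌊ inBand? I J y ⌋) (parent x))
              + sum (map (λ y → b2n ⌊ inBand? I J y ⌋) (children x))
    split = sum-map-++ _ (parent x) (children x)
    by-level : Tri (l < J) (l ≡ J) (l > J) → Tri (I < l) (I ≡ l) (I > l) → c (depth x) < inBand-neighbours I J x
    by-level (tri> _ _ l>J) _ = ⊥-elim (<⇒≱ l>J l≤J)
    by-level (tri≈ _ l≡J _) _ = subst (_< inBand-neighbours I J x) (sym (trans (cong c (at l≡J)) cP≡0))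
      (≤-trans (parent-inBand x (subst (I <_) (sym l≡J) i<P) l≤J) (≤-trans (m≤m+n _ _) (≤-reflexive (sym split))))
    by-level (tri< l<J _ _) (tri> _ _ I>l) = ⊥-elim (<⇒≱ I>l I≤l)
    by-level (tri< l<J _ _) (tri≈ _ I≡l _) = subst (λ t → c t < inBand-neighbours I J x) (sym (at (sym I≡l)))
      (<-≤-trans ci<m (≤-trans (children-inBand x I≤l l<J (Finₚ.toℕ<n P))
                               (≤-trans (m≤n+m _ _) (≤-reflexive (sym split)))))
    by-level (tri< l<J _ _) (tri< I<l _ _) = <-≤-trans (stable (depth x))
      (≤-trans (+-mono-≤ (parent-inBand x I<l l≤J) (children-inBand x I≤l l<J (Finₚ.toℕ<n P)))
               (≤-reflexive (sym split)))

  recurrent-empty⇒full-below : ∀ {c} → Recurrent (levelConfig c) →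
    ∀ P i → c P ≡ 0 → toℕ i < toℕ P → c i ≡ m
  recurrent-empty⇒full-below {c} (stable , w , w≢0 , (D , _)) P i cP≡0 i<P with c i ≟ m
  ... | yes ci≡m = ci≡m
  ... | no ci≢m with last-toppler D (inBand? (toℕ i) (toℕ P)) (λ y _ → all-topple D w≢0 y) {spine P} spine-inBand
    where
    spine-inBand : InBand (toℕ i) (toℕ P) (spine P)
    spine-inBand = subst (toℕ i ≤_) (sym (length-replicate (toℕ P))) (<⇒≤ i<P)
                 , ≤-reflexive (length-replicate (toℕ P))
  ...   | x , inBand , bound = ⊥-elim (<⇒≱ exceed bound)
    where
    ci<m = ≤∧≢⇒< (≤-pred (stable-levels stable i)) ci≢m
    exceed = inBand-neighbours-exceed (stable-levels stable) P i cP≡0 ci<m i<P x inBand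

  module _ (a : LevelVec) (K : Fin (n ∸ 1)) (full : ∀ t → toℕ t < toℕ K → a t ≡ m) (room : a K < m) where
    private
      k = toℕ K
      b = cascaded a k

      grows-only-at-K : ∀ t → a t < b t → toℕ t ≡ k
      grows-only-at-K t a<b with <-cmp (toℕ t) k
      ... | tri< t<k _ _ = ⊥-elim (<⇒≱ a<b (subst (b t ≤_) (sym (full t t<k)) (afterCascade-below k (toℕ t) (a t) t<k)))
      ... | tri≈ _ t≡k _ = t≡k
      ... | tri> _ _ t>k = ⊥-elim (<-irrefl (sym (afterCascade-above k (toℕ t) (a t) t>k)) a<b)

      grows-by-one : ∀ t → b t ≤ suc (a t)
      grows-by-one t with <-cmp (toℕ t) k
      ... | tri< t<k _ _ =
        ≤-trans (afterCascade-below k (toℕ t) (a t) t<k) (≤-trans (≤-reflexive (sym (full t t<k))) (n≤1+n (a t)))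
      ... | tri≈ _ t≡k _ = ≤-reflexive (trans (cong (λ j → afterCascade k j (a t)) t≡k) (afterCascade-at k (a t)))
      ... | tri> _ _ t>k = ≤-trans (≤-reflexive (afterCascade-above k (toℕ t) (a t) t>k)) (n≤1+n (a t))

      a<b : a <lex b
      a<b = K , (λ j j>k → sym (afterCascade-above k (toℕ j) (a j) j>k))
              , subst (a K <_) (sym (afterCascade-at k (a K))) (n<1+n (a K))

      recurrent-≥-cascade : ∀ c → Recurrent (levelConfig c) → ∀ j → toℕ j < k →
        (∀ t → toℕ j < toℕ t → c t ≡ b t) → b j ≤ c j
      recurrent-≥-cascade c rec j j<k above with m≤n⇒m<n∨m≡n j<k
      ... | inj₂ j+1≡k = subst (_≤ c j) (sym bj≡0) z≤n
        where
        bj≡0 = trans (cong (λ k → afterCascade k (toℕ j) (a j)) (sym j+1≡k)) (afterCascade-emptied (toℕ j) (a j))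
      ... | inj₁ j+2≤k =
        ≤-reflexive (trans (afterCascade-full k (toℕ j) (a j) j+2≤k) (sym (recurrent-empty⇒full-below rec P j cP≡0 j<P)))
        where
        p = pred k
        k≡p+1 : k ≡ suc p
        k≡p+1 = sym (suc-pred k {{>-nonZero (<-≤-trans (s≤s z≤n) j+2≤k)}})
        P = fromℕ< (≤-<-trans pred[n]≤n (Finₚ.toℕ<n K))
        toℕP : toℕ P ≡ p
        toℕP = Finₚ.toℕ-fromℕ< _
        j<P : toℕ j < toℕ P
        j<P = subst (toℕ j <_) (sym toℕP) (≤-pred (subst (suc (suc (toℕ j)) ≤_) k≡p+1 j+2≤k))
        cP≡0 : c P ≡ 0
        cP≡0 = trans (above P j<P)
                     (trans (cong₂ (λ k t → afterCascade k t (a P)) k≡p+1 toℕP) (afterCascade-emptied p (a P)))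

      nothing-between : ∀ c → Recurrent (levelConfig c) → ¬ (a <lex c × c <lex b)
      nothing-between c rec@(stable , _) ((k₁ , above₁ , a<c) , (k₂ , above₂ , c<b)) with <-cmp (toℕ k₁) (toℕ k₂)
      ... | tri< k₁<k₂ _ _ = <⇒≱ (stable-levels stable k₁) (subst (_< c k₁) (full k₁ k₁<k) a<c)
        where
        k₁<k = subst (toℕ k₁ <_) (grows-only-at-K k₂ (subst (_< b k₂) (sym (above₁ k₂ k₁<k₂)) c<b)) k₁<k₂
      ... | tri≈ _ k₁≡k₂ _ =
        <⇒≱ (<-≤-trans (s≤s a<c) (subst (λ t → c t < b t) (sym (Finₚ.toℕ-injective k₁≡k₂)) c<b)) (grows-by-one k₁)
      ... | tri> _ _ k₁>k₂ = <⇒≱ c<b (recurrent-≥-cascade c rec k₂ k₂<k above₂)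
        where
        k₂<k = subst (toℕ k₂ <_) (grows-only-at-K k₁ (subst (a k₁ <_) (above₂ k₁ k₁>k₂) a<c)) k₁>k₂

    cascade-immediate : ImmediateSucc a b
    cascade-immediate = a<b , nothing-between

    cascade-stable : (∀ t → a t < d) → ∀ t → b t < d
    cascade-stable stable t with <-cmp (toℕ t) k
    ... | tri< t<k _ _ = s≤s (afterCascade-below k (toℕ t) (a t) t<k)
    ... | tri≈ _ t≡k _ =
      subst (λ t → b t < d) (sym (Finₚ.toℕ-injective t≡k)) (subst (_< d) (sym (afterCascade-at k (a K))) (s≤s room))
    ... | tri> _ _ t>k = subst (_< d) (sym (afterCascade-above k (toℕ t) (a t) t>k)) (stable t)

  Successor : LevelVec → LevelVec → Set
  Successor a b = ImmediateSucc a b ⊎ ((∀ j → a j ≡ allMax j) × (∀ j → b j ≡ wrapVec j))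

  add-root-chip : ∀ a → (∀ t → a t < d) →
    ∃ λ b → (∀ t → b t < d) × Reach (levelConfig a ⊕ kδr 1) (levelConfig b) × Successor a b
  add-root-chip a stable with Finₚ.all? (λ t → a t ≟ m)
  ... | yes all-full =
    cascaded a (n ∸ 1) , (λ t → s≤s (afterCascade-below (n ∸ 1) (toℕ t) (a t) (Finₚ.toℕ<n t))) ,
    cascade a (n ∸ 1) ≤-refl (λ t _ → all-full t) , inj₂ (all-full , wrapped)
    where
    wrapped : ∀ t → cascaded a (n ∸ 1) t ≡ wrapVec t
    wrapped t = afterCascade-last n′ (toℕ t) (a t) (Finₚ.toℕ<n t)
  ... | no ¬all-full with Finₚ.¬∀⟶∃¬-smallest _ _ (λ t → a t ≟ m) ¬all-full
  ...   | K , aK≢m , below =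
    cascaded a (toℕ K) , cascade-stable a K full room stable , cascade a (toℕ K) (<⇒≤ (Finₚ.toℕ<n K)) full ,
    inj₁ (cascade-immediate a K full room)
    where
    room : a K < m
    room = ≤∧≢⇒< (≤-pred (stable K)) aK≢m
    full : ∀ t → toℕ t < toℕ K → a t ≡ m
    full t t<K = subst (λ t → a t ≡ m) t≡ (below (fromℕ< t<K))
      where
      t≡ = Finₚ.toℕ-injective (trans (Finₚ.toℕ-inject (fromℕ< t<K)) (Finₚ.toℕ-fromℕ< t<K))

  multiple-on-levels : ∀ {e} → IsIdentity e → ∀ k →
    ∃ λ a → (∀ t → a t < d) × Reach (e ⊕ kδr k) (levelConfig a)
  multiple-on-levels {e} isId zero =
    (λ t → e (spine t)) , (λ t → proj₁ (proj₁ isId) (spine t)) ,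
    done (λ w → trans (cong (e w +_) (kδr-zero w)) (trans (+-identityʳ (e w)) (identity-level isId w)))
  multiple-on-levels {e} isId (suc k) with multiple-on-levels isId k
  ... | a , stable , r with add-root-chip a stable
  ...   | b , stable′ , r′ , _ = b , stable′ , reach-next-multiple e k r r′

  multiples-⇝ : ∀ {e} → IsIdentity e → ∀ k {u v} → Stab (e ⊕ kδr k) u → Stab (e ⊕ kδr (suc k)) v → u ⇝ v
  multiples-⇝ {e} isId@(rec , _) k su sv with multiple-on-levels isId k
  ... | a , stable , r with add-root-chip a stable
  ...   | b , stable′ , r′ , succ =
    stab-recurrent rec su , stab-recurrent rec sv , a , b ,
    stab-unique su (r , stable ∘ depth) ,
    stab-unique sv (reach-next-multiple e k r r′ , stable′ ∘ depth) ,
    succ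

lemma4p1 : (d n : ℕ) → 3 ≤ d → 2 ≤ n →
    (e : Sandpile.Config d n) → Sandpile.IsIdentity d n e →
    (k : ℕ) (u v : Sandpile.Config d n) →
    Sandpile.Stab d n (Sandpile._⊕_ d n e (Sandpile.kδr d n k)) u →
    Sandpile.Stab d n (Sandpile._⊕_ d n e (Sandpile.kδr d n (suc k))) v →
    Sandpile._⇝_ d n u v
lemma4p1 (suc (suc d′)) (suc (suc n′)) (s≤s (s≤s _)) (s≤s (s≤s z≤n)) e isId k u v =
  WiredTree.multiples-⇝ d′ n′ isId k
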